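{- Let $n\ge 2$ be even and $1\le\Delta\le\lfloor\log_2 n\rfloor$, and consider the Kn\"odel graph $W_{\Delta,n}$ with partite sets $U=\{u_1,\dots,u_{n/2}\}$ and $V=\{v_1,\dots,v_{n/2}\}$. For every non-empty subset $A\subseteq U$: (i) $\sum_{v\in N(A)}|N(v)\cap A|=\Delta|A|$; (ii) if $n_1,\dots,n_{|A|}$ is the cyclic-sequence of $A$, then the number of indices $j\in\{1,\dots,|A|\}$ with $n_j\in\mathscr{M}_\Delta$ is at most $\Delta|A|-|N(A)|$.
   Context: The Kn\"odel graph $W_{\Delta,n}$ (for even $n\ge2$, $1\le\Delta\le\lfloor\log_2 n\rfloor$) is the bipartite graph with partite sets $U=\{u_1,\dots,u_{n/2}\}$ and $V=\{v_1,\dots,v_{n/2}\}$ in which $u_i$ and $v_j$ are adjacent if and only if $j\equiv i+2^k-1 \pmod{n/2}$ for some $k\in\{0,1,\dots,\Delta-1\}$ (indices taken in $\{1,\dots,n/2\}$). $N(x)$ denotes the open neighborhood of a vertex $x$ and $N(S)=\bigcup_{x\in S}N(x)$. For $A=\{u_{i_1},\dots,u_{i_k}\}\subseteq U$ with $1\le i_1<i_2<\dots<i_k\le n/2$, the cyclic-sequence of $A$ is $n_1,\dots,n_k$ where $n_j=i_{j+1}-i_j$ for $1\le j\le k-1$ and $n_k=\frac{n}{2}+i_1-i_k$. The set $\mathscr{M}_\Delta$ is $\{2^a-2^b: 0\le b<a<\Delta\}$ (integers $a,b$). -}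

module Defs where

open import Data.Bool using (Bool; true; false; _∧_; if_then_else_)
open import Data.Nat using (ℕ; zero; suc; _+_; _*_; _∸_; _^_; _≡ᵇ_; NonZero)
open import Data.Nat.DivMod using (_%_)
open import Data.Fin using (Fin; toℕ)
open import Data.Fin.Subset using (Subset; inside; outside)
open import Data.List using (List; []; _∷_; map; filter; length; upTo)
open import Data.Bool.ListAction using (any)
open import Data.Nat.ListAction using (sum)
open import Data.List as L using ()
open import Data.Vec using (tabulate; lookup)
open import Data.Vec as V using ()
open import Data.Bool using (T)
open import Relation.Nullary.Decidable using (Dec)
open import Data.Bool.Properties using (T?)

-- Vertices u_i and v_j of the Knödel graph W_{Δ,n} are indexed by Fin m
-- (m = n/2), with index i ∈ {0,…,m-1} standing for u_{i+1} (resp. v_{i+1}).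
-- adj m Δ i j = true  iff  u_{i+1} ~ v_{j+1}, i.e.
-- j ≡ i + 2^k - 1 (mod m) for some k ∈ {0,…,Δ-1}.
adj : (m Δ : ℕ) .{{_ : NonZero m}} → Fin m → Fin m → Bool
adj m Δ i j = any (λ k → ((toℕ i + 2 ^ k ∸ 1) % m) ≡ᵇ toℕ j) (upTo Δ)

mem : {m : ℕ} → Subset m → Fin m → Bool
mem A i = lookup A i

nbrU : (m Δ : ℕ) .{{_ : NonZero m}} → Subset m → Subset m
nbrU m Δ A = tabulate λ j → any (λ i → mem A i ∧ adj m Δ i j) (L.allFin m)

nbrV∩ : (m Δ : ℕ) .{{_ : NonZero m}} → Fin m → Subset m → Subset m
nbrV∩ m Δ j A = tabulate λ i → adj m Δ i j ∧ mem A i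

incidenceSum : (m Δ : ℕ) .{{_ : NonZero m}} → Subset m → ℕ
incidenceSum m Δ A =
  sum (map (λ j → Data.Fin.Subset.∣ nbrV∩ m Δ j A ∣)
           (filter (λ j → T? (mem (nbrU m Δ A) j)) (L.allFin m)))

-- indices of elements of A in increasing order (0-based; shifting all
-- indices by 1 does not change the cyclic-sequence)
indices : {m : ℕ} → Subset m → List ℕ
indices {m} A = map toℕ (filter (λ i → T? (mem A i)) (L.allFin m))

cycGo : (m first : ℕ) → List ℕ → List ℕ
cycGo m first [] = []
cycGo m first (a ∷ []) = (m + first ∸ a) ∷ []
cycGo m first (a ∷ b ∷ r) = (b ∸ a) ∷ cycGo m first (b ∷ r)

cyclicSeq : {m : ℕ} → Subset m → List ℕ
cyclicSeq {m} A with indices A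
... | [] = []
... | x ∷ xs = cycGo m x (x ∷ xs)

inM : ℕ → ℕ → Bool
inM Δ x = any (λ a → any (λ b → x ≡ᵇ (2 ^ a ∸ 2 ^ b)) (upTo a)) (upTo Δ)

countM : {m : ℕ} → ℕ → Subset m → ℕ
countM Δ A = length (filter (λ x → T? (inM Δ x)) (cyclicSeq A))

module Submission where

-- Vertices u_{x+1}, v_{x+1}
-- are identified with x < m, and u_x is adjacent to v_{shift m k x}, where
-- shift m k x = (x + 2^k − 1) mod m, for k < Δ.
--
-- (i)  Δ ≤ ⌊log₂ 2m⌋ means 2^k ≤ m for every k < Δ, so the Δ offsets 2^k − 1
--      are distinct residues and every u ∈ U has degree Δ.  The incidence sum
--      counts the edges between A and V; exchanging the order of summation
--      gives Σ_{u ∈ A} deg u = Δ|A|.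
-- (ii) Let I list the indices of A, layer k the k-th neighbours of I and
--      reach a = layer 0 ++ … ++ layer (a − 1), so N(A) is the set of values of
--      reach Δ.  Appending layer k adds at most |A| − r_k new values, where r_k
--      counts the x ∈ I whose k-th neighbour already lies in reach k; hence
--      |N(A)| + Σ_{k<Δ} r_k ≤ Δ|A|.  If a cyclic gap i_{j+1} − i_j is 2^a − 2^b
--      with b < a < Δ, the a-th neighbour of i_j is the b-th neighbour of
--      i_{j+1}, so i_j is counted in r_a.  Part (ii) needs no bound on Δ.

open import Defs
open import Data.Nat using (ℕ; _*_; _+_; _≤_; NonZero)
open import Data.Nat.Logarithm using (⌊log₂_⌋)
open import Data.Fin.Subset using (Subset; Nonempty; ∣_∣)
open import Data.Product using (_×_)
open import Relation.Binary.PropositionalEquality using (_≡_)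

import Algebra.Properties.CommutativeSemigroup as CommutativeSemigroupProperties
import Algebra.Properties.Semiring.Sum as SemiringSum
open import Data.Bool using (Bool; true; false; _∧_; _∨_; T)
open import Data.Bool.ListAction using (any)
open import Data.Bool.Properties using (T?; T-∨; T-∧; ∧-identityʳ; ∧-zeroʳ)
open import Data.Empty using (⊥; ⊥-elim)
open import Data.Fin using (Fin; toℕ)
open import Data.Fin.Properties using (toℕ<n)
open import Data.List using (List; []; _∷_; map; filter; length; upTo; tabulate; allFin; _++_)
open import Data.List.Membership.DecPropositional Data.Nat._≟_ using (_∈_; _∈?_)
open import Data.List.Membership.Propositional.Properties using (∈-map⁺; ∈-map⁻; ∈-filter⁺; ∈-filter⁻; ∈-++⁺ˡ; ∈-++⁺ʳ; ∈-++⁻; ∈-allFin)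
open import Data.List.Properties using (++-identityʳ; length-map)
open import Data.List.Relation.Binary.Permutation.Propositional using (_↭_; ↭-sym)
open import Data.List.Relation.Binary.Permutation.Propositional.Properties using (∈-resp-↭) renaming (shift to ↭-shift)
open import Data.List.Relation.Unary.Any using (here; there; satisfied) renaming (map to Any-map)
open import Data.List.Relation.Unary.Any.Properties using (any⁺; any⁻; applyUpTo⁺; applyUpTo⁻)
open import Data.Nat using (zero; suc; _∸_; _^_; _<_; _≡ᵇ_; z≤n; s≤s; ⌊_/2⌋; ⌈_/2⌉; >-nonZero⁻¹)
open import Data.Nat.DivMod using (_%_; %-distribˡ-+; [m+n]%n≡m%n; [m+kn]%n≡m%n; m<n⇒m%n≡m; m%n<n)
open import Data.Nat.ListAction using (sum)
open import Data.Nat.Logarithm using (⌊log₂⌊n/2⌋⌋≡⌊log₂n⌋∸1; ⌊log₂[2*b]⌋≡1+⌊log₂b⌋)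
open import Data.Nat.Properties
open import Data.Product using (∃-syntax; _,_; proj₂)
open import Data.Sum using (inj₁; inj₂)
open import Data.Vec using (lookup) renaming (_∷_ to _∷ᵥ_; [] to []ᵥ; tabulate to tabulateᵥ)
open import Data.Vec.Properties using (lookup∘tabulate)
open import Function using (_∘_; id; Equivalence)
open import Relation.Binary.PropositionalEquality using (refl; sym; trans; cong; cong₂; subst; module ≡-Reasoning)
open import Relation.Binary.Definitions using (tri<; tri≈; tri>)
open import Relation.Nullary using (¬_; yes; no; isYes)
open import Relation.Nullary.Decidable using (toWitness; fromWitness)

open Equivalence using (to; from)
open CommutativeSemigroupProperties +-commutativeSemigroup using (interchange; x∙yz≈xz∙y; xy∙z≈xz∙y)
open SemiringSum +-*-semiring
  using (sum-syntax; sum-cong-≗; ∑-comm; ∑-distrib-+; *-distribˡ-sum; sum-replicate-zero)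

𝟙 : Bool → ℕ
𝟙 true  = 1
𝟙 false = 0

T-ext : ∀ {x y} → (T x → T y) → (T y → T x) → x ≡ y
T-ext {true}  {true}  _ _ = refl
T-ext {true}  {false} f _ = ⊥-elim (f _)
T-ext {false} {true}  _ g = ⊥-elim (g _)
T-ext {false} {false} _ _ = refl

𝟙-mono : ∀ {x y} → (T x → T y) → 𝟙 x ≤ 𝟙 y
𝟙-mono {true}  {true}  _ = ≤-refl
𝟙-mono {true}  {false} f = ⊥-elim (f _)
𝟙-mono {false}         _ = z≤n

𝟙-∨ : ∀ x y → 𝟙 (x ∨ y) ≤ 𝟙 x + 𝟙 y
𝟙-∨ true  _ = s≤s z≤n
𝟙-∨ false _ = ≤-refl

𝟙-∨-disjoint : ∀ x y → (T x → T y → ⊥) → 𝟙 (x ∨ y) ≡ 𝟙 x + 𝟙 y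
𝟙-∨-disjoint true  true  d = ⊥-elim (d _ _)
𝟙-∨-disjoint true  false _ = refl
𝟙-∨-disjoint false _     _ = refl

∑-mono-≤ : ∀ {m} {f g : Fin m → ℕ} → (∀ i → f i ≤ g i) → ∑[ i < m ] f i ≤ ∑[ i < m ] g i
∑-mono-≤ {zero}  _ = z≤n
∑-mono-≤ {suc m} h = +-mono-≤ (h Fin.zero) (∑-mono-≤ (h ∘ Fin.suc))

count : (m : ℕ) → (Fin m → Bool) → ℕ
count m p = ∑[ i < m ] 𝟙 (p i)

module _ (m : ℕ) where

  count-cong : {p q : Fin m → Bool} → (∀ i → p i ≡ q i) → count m p ≡ count m q
  count-cong e = sum-cong-≗ (cong 𝟙 ∘ e)

  count-mono : {p q : Fin m → Bool} → (∀ i → T (p i) → T (q i)) → count m p ≤ count m q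
  count-mono h = ∑-mono-≤ (𝟙-mono ∘ h)

  count-none : {p : Fin m → Bool} → (∀ i → ¬ T (p i)) → count m p ≡ 0
  count-none h = n≤0⇒n≡0 (≤-trans (count-mono h) (≤-reflexive (sum-replicate-zero m)))

  count-∨ : (p q : Fin m → Bool) → count m (λ i → p i ∨ q i) ≤ count m p + count m q
  count-∨ p q = ≤-trans (∑-mono-≤ (λ i → 𝟙-∨ (p i) (q i))) (≤-reflexive (∑-distrib-+ (𝟙 ∘ p) (𝟙 ∘ q)))

  count-∨-disjoint : (p q : Fin m → Bool) → (∀ i → T (p i) → T (q i) → ⊥) →
    count m (λ i → p i ∨ q i) ≡ count m p + count m q
  count-∨-disjoint p q d = trans (sum-cong-≗ (λ i → 𝟙-∨-disjoint (p i) (q i) (d i))) (∑-distrib-+ (𝟙 ∘ p) (𝟙 ∘ q))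

count-≡ᵇ≤1 : ∀ m v → count m (λ j → v ≡ᵇ toℕ j) ≤ 1
count-≡ᵇ≤1 zero    _       = z≤n
count-≡ᵇ≤1 (suc m) zero    = ≤-reflexive (cong suc (sum-replicate-zero m))
count-≡ᵇ≤1 (suc m) (suc v) = count-≡ᵇ≤1 m v

count-≡ᵇ : ∀ m v → v < m → count m (λ j → v ≡ᵇ toℕ j) ≡ 1
count-≡ᵇ (suc m) zero    _         = cong suc (sum-replicate-zero m)
count-≡ᵇ (suc m) (suc v) (s≤s v<m) = count-≡ᵇ m v v<m

∣∣≡count : ∀ {m} (A : Subset m) → ∣ A ∣ ≡ count m (lookup A)
∣∣≡count []ᵥ         = refl
∣∣≡count (true ∷ᵥ A)  = cong suc (∣∣≡count A)
∣∣≡count (false ∷ᵥ A) = ∣∣≡count A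

∣tabulate∣ : ∀ {m} (p : Fin m → Bool) → ∣ tabulateᵥ p ∣ ≡ count m p
∣tabulate∣ {m} p = trans (∣∣≡count (tabulateᵥ p)) (count-cong m (lookup∘tabulate p))

countL : {X : Set} → (X → Bool) → List X → ℕ
countL p []       = 0
countL p (x ∷ xs) = 𝟙 (p x) + countL p xs

module _ {X : Set} where

  length-filter : (p : X → Bool) (xs : List X) → length (filter (T? ∘ p) xs) ≡ countL p xs
  length-filter p []       = refl
  length-filter p (x ∷ xs) with p x
  ... | true  = cong suc (length-filter p xs)
  ... | false = length-filter p xs

  countL-tabulate : ∀ {m} (p : X → Bool) (g : Fin m → X) → countL p (tabulate g) ≡ count m (p ∘ g)
  countL-tabulate {zero}  p g = refl
  countL-tabulate {suc m} p g = cong (𝟙 (p (g Fin.zero)) +_) (countL-tabulate p (g ∘ Fin.suc))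

  countL-false : (xs : List X) → countL (λ _ → false) xs ≡ 0
  countL-false []       = refl
  countL-false (_ ∷ xs) = countL-false xs

  countL-∨ : (p q : X → Bool) (xs : List X) → countL (λ x → p x ∨ q x) xs ≤ countL p xs + countL q xs
  countL-∨ p q []       = z≤n
  countL-∨ p q (x ∷ xs) = begin
    𝟙 (p x ∨ q x) + countL (λ x → p x ∨ q x) xs   ≤⟨ +-mono-≤ (𝟙-∨ (p x) (q x)) (countL-∨ p q xs) ⟩
    (𝟙 (p x) + 𝟙 (q x)) + (countL p xs + countL q xs) ≡⟨ interchange (𝟙 (p x)) (𝟙 (q x)) _ _ ⟩
    (𝟙 (p x) + countL p xs) + (𝟙 (q x) + countL q xs) ∎
    where open ≤-Reasoning

  sum-filter-tabulate : ∀ {m} (g : Fin m → X) (p : X → Bool) (h : X → ℕ) →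
    (∀ x → p x ≡ false → h x ≡ 0) →
    sum (map h (filter (T? ∘ p) (tabulate g))) ≡ ∑[ j < m ] h (g j)
  sum-filter-tabulate {zero}  g p h vanish = refl
  sum-filter-tabulate {suc m} g p h vanish with p (g Fin.zero) in eq
  ... | true  = cong (h (g Fin.zero) +_) (sum-filter-tabulate (g ∘ Fin.suc) p h vanish)
  ... | false = trans (sum-filter-tabulate (g ∘ Fin.suc) p h vanish)
                      (cong (_+ ∑[ j < m ] h (g (Fin.suc j))) (sym (vanish (g Fin.zero) eq)))

module _ (p : ℕ → Bool) where

  any-upTo⁻ : ∀ {n} → T (any p (upTo n)) → ∃[ k ] k < n × T (p k)
  any-upTo⁻ t = applyUpTo⁻ id (any⁻ p _ t)

  any-upTo⁺ : ∀ {n k} → k < n → T (p k) → T (any p (upTo n))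
  any-upTo⁺ k<n t = any⁺ p (applyUpTo⁺ id t k<n)

  any-upTo-suc : ∀ n → any p (upTo (suc n)) ≡ any p (upTo n) ∨ p n
  any-upTo-suc n = T-ext split join
    where
    split : T (any p (upTo (suc n))) → T (any p (upTo n) ∨ p n)
    split t with any-upTo⁻ t
    ... | k , k<1+n , pk with m<1+n⇒m<n∨m≡n k<1+n
    ...   | inj₁ k<n  = from (T-∨ {any p (upTo n)}) (inj₁ (any-upTo⁺ k<n pk))
    ...   | inj₂ refl = from (T-∨ {any p (upTo n)}) (inj₂ pk)
    join : T (any p (upTo n) ∨ p n) → T (any p (upTo (suc n)))
    join t with to (T-∨ {any p (upTo n)}) t
    ... | inj₁ u = let k , k<n , pk = any-upTo⁻ {n} u in any-upTo⁺ (m<n⇒m<1+n k<n) pk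
    ... | inj₂ u = any-upTo⁺ ≤-refl u

-- Residues modulo m: adding a constant respects congruence, and translation
-- by a is injective on residues (add a·m − a to both sides and drop a·m).
module _ (m : ℕ) .{{_ : NonZero m}} where

  %-cong-+ʳ : ∀ {x y} t → x % m ≡ y % m → (x + t) % m ≡ (y + t) % m
  %-cong-+ʳ {x} {y} t e = begin
    (x + t) % m                 ≡⟨ %-distribˡ-+ x t m ⟩
    (x % m + t % m) % m         ≡⟨ cong (λ r → (r + t % m) % m) e ⟩
    (y % m + t % m) % m         ≡⟨ %-distribˡ-+ y t m ⟨
    (y + t) % m                 ∎
    where open ≡-Reasoning

  +-cancelˡ-% : ∀ a {b c} → (a + b) % m ≡ (a + c) % m → b % m ≡ c % m
  +-cancelˡ-% a {b} {c} e = begin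
    b % m                       ≡⟨ [m+kn]%n≡m%n b a m ⟨
    (b + a * m) % m             ≡⟨ cong (_% m) (complete b) ⟩
    (a + b + (a * m ∸ a)) % m   ≡⟨ %-cong-+ʳ (a * m ∸ a) e ⟩
    (a + c + (a * m ∸ a)) % m   ≡⟨ cong (_% m) (complete c) ⟨
    (c + a * m) % m             ≡⟨ [m+kn]%n≡m%n c a m ⟩
    c % m                       ∎
    where
    open ≡-Reasoning
    complete : ∀ x → x + a * m ≡ a + x + (a * m ∸ a)
    complete x = begin
      x + a * m                 ≡⟨ cong (x +_) (m+[n∸m]≡n (m≤m*n a m)) ⟨
      x + (a + (a * m ∸ a))     ≡⟨ +-assoc x a _ ⟨
      x + a + (a * m ∸ a)       ≡⟨ cong (_+ (a * m ∸ a)) (+-comm x a) ⟩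
      a + x + (a * m ∸ a)       ∎

2^-injective : ∀ {k l} → 2 ^ k ≡ 2 ^ l → k ≡ l
2^-injective {k} {l} e with <-cmp k l
... | tri< k<l _ _ = ⊥-elim (<-irrefl e (^-monoʳ-< 2 (s≤s (s≤s z≤n)) k<l))
... | tri≈ _ k≡l _ = k≡l
... | tri> _ _ l<k = ⊥-elim (<-irrefl (sym e) (^-monoʳ-< 2 (s≤s (s≤s z≤n)) l<k))

2*⌊n/2⌋≤n : ∀ n → 2 * ⌊ n /2⌋ ≤ n
2*⌊n/2⌋≤n n = begin
  ⌊ n /2⌋ + (⌊ n /2⌋ + 0) ≡⟨ cong (⌊ n /2⌋ +_) (+-identityʳ ⌊ n /2⌋) ⟩
  ⌊ n /2⌋ + ⌊ n /2⌋       ≤⟨ +-monoʳ-≤ ⌊ n /2⌋ (⌊n/2⌋≤⌈n/2⌉ n) ⟩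
  ⌊ n /2⌋ + ⌈ n /2⌉       ≡⟨ ⌊n/2⌋+⌈n/2⌉≡n n ⟩
  n                       ∎
  where open ≤-Reasoning

2^≤ : ∀ k n → 1 ≤ n → k ≤ ⌊log₂ n ⌋ → 2 ^ k ≤ n
2^≤ zero    n             1≤n _ = 1≤n
2^≤ (suc k) (suc zero)    _   ()
2^≤ (suc k) n@(suc (suc _)) _ k<log = begin
  2 * 2 ^ k     ≤⟨ *-monoʳ-≤ 2 (2^≤ k ⌊ n /2⌋ (s≤s z≤n) k≤log-half) ⟩
  2 * ⌊ n /2⌋   ≤⟨ 2*⌊n/2⌋≤n n ⟩
  n             ∎
  where
  open ≤-Reasoning
  k≤log-half : k ≤ ⌊log₂ ⌊ n /2⌋ ⌋
  k≤log-half = subst (k ≤_) (sym (⌊log₂⌊n/2⌋⌋≡⌊log₂n⌋∸1 n)) (∸-monoˡ-≤ 1 k<log)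

offset : ℕ → ℕ
offset k = 2 ^ k ∸ 1

shift : (m : ℕ) .{{_ : NonZero m}} → ℕ → ℕ → ℕ
shift m k x = (x + 2 ^ k ∸ 1) % m

1≤2^ : ∀ k → 1 ≤ 2 ^ k
1≤2^ = m^n>0 2

shift≡ : ∀ m .{{_ : NonZero m}} k x → shift m k x ≡ (x + offset k) % m
shift≡ m k x = cong (_% m) (+-∸-assoc x (1≤2^ k))

-- Offsets differ exactly by the elements 2^a − 2^b of 𝓜_Δ.
offset-gap : ∀ {a b} → b < a → offset a ≡ (2 ^ a ∸ 2 ^ b) + offset b
offset-gap {a} {b} b<a = begin
  2 ^ a ∸ 1                         ≡⟨ cong (_∸ 1) (m∸n+n≡m 2^b≤2^a) ⟨
  (2 ^ a ∸ 2 ^ b) + 2 ^ b ∸ 1       ≡⟨ +-∸-assoc (2 ^ a ∸ 2 ^ b) (1≤2^ b) ⟩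
  (2 ^ a ∸ 2 ^ b) + (2 ^ b ∸ 1)     ∎
  where
  open ≡-Reasoning
  2^b≤2^a : 2 ^ b ≤ 2 ^ a
  2^b≤2^a = ^-monoʳ-≤ 2 (<⇒≤ b<a)

shift-injective : ∀ m .{{_ : NonZero m}} {k l} x → 2 ^ k ≤ m → 2 ^ l ≤ m →
  shift m k x ≡ shift m l x → k ≡ l
shift-injective m {k} {l} x 2^k≤m 2^l≤m e =
  2^-injective (∸-cancelʳ-≡ (1≤2^ k) (1≤2^ l) offsets-equal)
  where
  offset<m : ∀ j → 2 ^ j ≤ m → offset j < m
  offset<m j 2^j≤m = <-≤-trans (∸-monoʳ-< (s≤s z≤n) (1≤2^ j)) 2^j≤m
  offsets-equal : offset k ≡ offset l
  offsets-equal = begin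
    offset k       ≡⟨ m<n⇒m%n≡m (offset<m k 2^k≤m) ⟨
    offset k % m   ≡⟨ +-cancelˡ-% m x (trans (sym (shift≡ m k x)) (trans e (shift≡ m l x))) ⟩
    offset l % m   ≡⟨ m<n⇒m%n≡m (offset<m l 2^l≤m) ⟩
    offset l       ∎
    where open ≡-Reasoning

module _ (m : ℕ) .{{_ : NonZero m}} where

  degree : ∀ Δ {x} → x < m → (∀ k → k < Δ → 2 ^ k ≤ m) →
    count m (λ j → any (λ k → shift m k x ≡ᵇ toℕ j) (upTo Δ)) ≡ Δ
  degree zero    _   _     = sum-replicate-zero m
  degree (suc Δ) {x} x<m small = begin
    count m (λ j → any (hits j) (upTo (suc Δ)))
      ≡⟨ count-cong m (λ j → any-upTo-suc (hits j) Δ) ⟩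
    count m (λ j → any (hits j) (upTo Δ) ∨ hits j Δ)
      ≡⟨ count-∨-disjoint m _ _ new ⟩
    count m (λ j → any (hits j) (upTo Δ)) + count m (λ j → hits j Δ)
      ≡⟨ cong₂ _+_ (degree Δ x<m (λ k → small k ∘ m<n⇒m<1+n)) (count-≡ᵇ m (shift m Δ x) (m%n<n _ m)) ⟩
    Δ + 1
      ≡⟨ +-comm Δ 1 ⟩
    suc Δ
      ∎
    where
    open ≡-Reasoning
    hits : Fin m → ℕ → Bool
    hits j k = shift m k x ≡ᵇ toℕ j
    new : ∀ j → T (any (hits j) (upTo Δ)) → T (hits j Δ) → ⊥
    new j old last with any-upTo⁻ (hits j) old
    ... | k , k<Δ , hit = <-irrefl (shift-injective m x (small k (m<n⇒m<1+n k<Δ)) (small Δ ≤-refl)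
                                      (trans (≡ᵇ⇒≡ _ _ hit) (sym (≡ᵇ⇒≡ _ _ last)))) k<Δ

  adj⁺ : ∀ {Δ k i j} → k < Δ → shift m k (toℕ i) ≡ toℕ j → T (adj m Δ i j)
  adj⁺ k<Δ e = any-upTo⁺ _ k<Δ (≡⇒≡ᵇ _ _ e)

  adj⁻ : ∀ {Δ i j} → T (adj m Δ i j) → ∃[ k ] k < Δ × shift m k (toℕ i) ≡ toℕ j
  adj⁻ t with any-upTo⁻ _ t
  ... | k , k<Δ , hit = k , k<Δ , ≡ᵇ⇒≡ _ _ hit

  nbrU⁺ : ∀ {Δ} (A : Subset m) {i j} → T (lookup A i) → T (adj m Δ i j) → T (lookup (nbrU m Δ A) j)
  nbrU⁺ {Δ} A {i} {j} i∈A i~j = subst T (sym (lookup∘tabulate _ j))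
    (any⁺ _ (Any-map (λ { refl → from (T-∧ {lookup A i}) (i∈A , i~j) }) (∈-allFin i)))

  nbrU⁻ : ∀ {Δ} (A : Subset m) {j} → T (lookup (nbrU m Δ A) j) → ∃[ i ] T (lookup A i) × T (adj m Δ i j)
  nbrU⁻ {Δ} A {j} t with satisfied (any⁻ _ (allFin m) (subst T (lookup∘tabulate _ j) t))
  ... | i , i∈A∧i~j = i , to (T-∧ {lookup A i}) i∈A∧i~j

-- Part (i), by double counting the edges between A and N(A): each v ∉ N(A)
-- contributes nothing, so the sum runs over all j; exchanging the two sums
-- leaves Σ_{u ∈ A} deg u = Δ|A|.
incidence-sum : ∀ m .{{_ : NonZero m}} Δ → (∀ k → k < Δ → 2 ^ k ≤ m) → (A : Subset m) →
  incidenceSum m Δ A ≡ Δ * ∣ A ∣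
incidence-sum m Δ small A = begin
  incidenceSum m Δ A
    ≡⟨ sum-filter-tabulate id (lookup (nbrU m Δ A)) (λ j → ∣ nbrV∩ m Δ j A ∣) outside-N ⟩
  ∑[ j < m ] ∣ nbrV∩ m Δ j A ∣
    ≡⟨ sum-cong-≗ (λ j → ∣tabulate∣ (λ i → adj m Δ i j ∧ lookup A i)) ⟩
  ∑[ j < m ] ∑[ i < m ] 𝟙 (adj m Δ i j ∧ lookup A i)
    ≡⟨ ∑-comm (λ j i → 𝟙 (adj m Δ i j ∧ lookup A i)) ⟩
  ∑[ i < m ] ∑[ j < m ] 𝟙 (adj m Δ i j ∧ lookup A i)
    ≡⟨ sum-cong-≗ (λ i → row i (lookup A i)) ⟩
  ∑[ i < m ] (Δ * 𝟙 (lookup A i))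
    ≡⟨ *-distribˡ-sum Δ (𝟙 ∘ lookup A) ⟨
  Δ * count m (lookup A)
    ≡⟨ cong (Δ *_) (∣∣≡count A) ⟨
  Δ * ∣ A ∣
    ∎
  where
  open ≡-Reasoning
  outside-N : ∀ j → lookup (nbrU m Δ A) j ≡ false → ∣ nbrV∩ m Δ j A ∣ ≡ 0
  outside-N j j∉N = trans (∣tabulate∣ (λ i → adj m Δ i j ∧ lookup A i)) (count-none m λ i i~j∧i∈A →
    let i~j , i∈A = to (T-∧ {adj m Δ i j}) i~j∧i∈A
    in subst T j∉N (nbrU⁺ m {Δ} A i∈A i~j))
  row : ∀ i b → count m (λ j → adj m Δ i j ∧ b) ≡ Δ * 𝟙 b
  row i true  = trans (count-cong m (λ j → ∧-identityʳ (adj m Δ i j)))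
                      (trans (degree m Δ (toℕ<n i) small) (sym (*-identityʳ Δ)))
  row i false = trans (count-none m (λ j → subst T (∧-zeroʳ (adj m Δ i j))))
                      (sym (*-zeroʳ Δ))

_∈ᵇ_ : ℕ → List ℕ → Bool
y ∈ᵇ l = isYes (y ∈? l)

distinct : (m : ℕ) → List ℕ → ℕ
distinct m l = count m (λ j → toℕ j ∈ᵇ l)

module _ (m : ℕ) where

  distinct-↭ : ∀ {l l'} → l ↭ l' → distinct m l ≡ distinct m l'
  distinct-↭ l↭l' = count-cong m λ j →
    T-ext (fromWitness ∘ ∈-resp-↭ l↭l' ∘ toWitness) (fromWitness ∘ ∈-resp-↭ (↭-sym l↭l') ∘ toWitness)

  distinct-∷ : ∀ y l → distinct m (y ∷ l) + 𝟙 (y ∈ᵇ l) ≤ suc (distinct m l)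
  distinct-∷ y l with y ∈? l
  ... | yes y∈l = ≤-reflexive (begin
    distinct m (y ∷ l) + 1   ≡⟨ cong (_+ 1) (count-cong m λ j →
                                  T-ext (fromWitness ∘ absorb ∘ toWitness) (fromWitness ∘ there ∘ toWitness)) ⟩
    distinct m l + 1         ≡⟨ +-comm (distinct m l) 1 ⟩
    suc (distinct m l)       ∎)
    where
    open ≡-Reasoning
    absorb : ∀ {z} → z ∈ y ∷ l → z ∈ l
    absorb (here refl) = y∈l
    absorb (there z∈l) = z∈l
  ... | no _ = begin
    distinct m (y ∷ l) + 0
      ≡⟨ +-identityʳ _ ⟩
    distinct m (y ∷ l)
      ≤⟨ count-mono m {p = λ j → toℕ j ∈ᵇ (y ∷ l)} (λ j → split j ∘ toWitness) ⟩
    count m (λ j → (y ≡ᵇ toℕ j) ∨ (toℕ j ∈ᵇ l))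
      ≤⟨ count-∨ m (λ j → y ≡ᵇ toℕ j) (λ j → toℕ j ∈ᵇ l) ⟩
    count m (λ j → y ≡ᵇ toℕ j) + distinct m l
      ≤⟨ +-monoˡ-≤ (distinct m l) (count-≡ᵇ≤1 m y) ⟩
    suc (distinct m l)
      ∎
    where
    open ≤-Reasoning
    split : ∀ j → toℕ j ∈ y ∷ l → T ((y ≡ᵇ toℕ j) ∨ (toℕ j ∈ᵇ l))
    split j (here j≡y)  = from (T-∨ {y ≡ᵇ toℕ j}) (inj₁ (≡⇒≡ᵇ y (toℕ j) (sym j≡y)))
    split j (there z∈l) = from (T-∨ {y ≡ᵇ toℕ j}) (inj₂ (fromWitness z∈l))

  distinct-++-map : ∀ P (g : ℕ → ℕ) xs →
    distinct m (P ++ map g xs) + countL (λ x → g x ∈ᵇ P) xs ≤ distinct m P + length xs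
  distinct-++-map P g []       = ≤-reflexive (cong (λ l → distinct m l + 0) (++-identityʳ P))
  distinct-++-map P g (x ∷ xs) = begin
    distinct m (P ++ y ∷ L) + (𝟙 (y ∈ᵇ P) + r)
      ≡⟨ cong (_+ (𝟙 (y ∈ᵇ P) + r)) (distinct-↭ (↭-shift y P L)) ⟩
    distinct m (y ∷ P ++ L) + (𝟙 (y ∈ᵇ P) + r)
      ≡⟨ +-assoc (distinct m (y ∷ P ++ L)) _ r ⟨
    distinct m (y ∷ P ++ L) + 𝟙 (y ∈ᵇ P) + r
      ≤⟨ +-monoˡ-≤ r (+-monoʳ-≤ (distinct m (y ∷ P ++ L)) P⊆P++L) ⟩
    distinct m (y ∷ P ++ L) + 𝟙 (y ∈ᵇ (P ++ L)) + r
      ≤⟨ +-monoˡ-≤ r (distinct-∷ y (P ++ L)) ⟩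
    suc (distinct m (P ++ L) + r)
      ≤⟨ s≤s (distinct-++-map P g xs) ⟩
    suc (distinct m P + length xs)
      ≡⟨ +-suc (distinct m P) (length xs) ⟨
    distinct m P + suc (length xs)
      ∎
    where
    open ≤-Reasoning
    y = g x
    L = map g xs
    r = countL (λ x → g x ∈ᵇ P) xs
    P⊆P++L : 𝟙 (y ∈ᵇ P) ≤ 𝟙 (y ∈ᵇ (P ++ L))
    P⊆P++L = 𝟙-mono {y ∈ᵇ P} (fromWitness ∘ ∈-++⁺ˡ ∘ toWitness)

inM⁻ : ∀ {Δ d} → T (inM Δ d) → ∃[ a ] a < Δ × ∃[ b ] b < a × d ≡ 2 ^ a ∸ 2 ^ b
inM⁻ {Δ} {d} t with any-upTo⁻ (λ a → any (λ b → d ≡ᵇ (2 ^ a ∸ 2 ^ b)) (upTo a)) {Δ} t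
... | a , a<Δ , t' with any-upTo⁻ _ t'
...   | b , b<a , d≡ = a , a<Δ , b , b<a , ≡ᵇ⇒≡ _ _ d≡

inM-positive : ∀ {Δ d} → T (inM Δ d) → 0 < d
inM-positive {Δ} {d} t with inM⁻ {Δ} {d} t
... | _ , _ , _ , b<a , refl = m<n⇒0<n∸m (^-monoʳ-< 2 (s≤s (s≤s z≤n)) b<a)

gap-closes : ∀ {u v} → 0 < v ∸ u → u + (v ∸ u) ≡ v
gap-closes {u} {v} pos = m+[n∸m]≡n (<⇒≤ (m∸n≢0⇒n<m {v} {u} (>⇒≢ pos)))

module Layers (m : ℕ) .{{_ : NonZero m}} (I : List ℕ) where

  layer : ℕ → List ℕ
  layer k = map (shift m k) I

  reach : ℕ → List ℕ
  reach zero    = []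
  reach (suc k) = reach k ++ layer k

  repeated : ℕ → ℕ → Bool
  repeated k x = shift m k x ∈ᵇ reach k

  redundant : ℕ → ℕ → Bool
  redundant zero    x = false
  redundant (suc k) x = redundant k x ∨ repeated k x

  repeats : ℕ → ℕ
  repeats zero    = 0
  repeats (suc k) = repeats k + countL (repeated k) I

  ∈-reach⁺ : ∀ {a k x} → k < a → x ∈ I → shift m k x ∈ reach a
  ∈-reach⁺ {suc a} k<1+a x∈I with m<1+n⇒m<n∨m≡n k<1+a
  ... | inj₁ k<a  = ∈-++⁺ˡ (∈-reach⁺ k<a x∈I)
  ... | inj₂ refl = ∈-++⁺ʳ (reach a) (∈-map⁺ (shift m a) x∈I)

  ∈-reach⁻ : ∀ {a y} → y ∈ reach a → ∃[ k ] k < a × ∃[ x ] x ∈ I × y ≡ shift m k x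
  ∈-reach⁻ {suc a} y∈ with ∈-++⁻ (reach a) y∈
  ... | inj₁ y∈reach = let k , k<a , rest = ∈-reach⁻ y∈reach in k , m<n⇒m<1+n k<a , rest
  ... | inj₂ y∈layer = let x , x∈I , y≡ = ∈-map⁻ (shift m a) y∈layer in a , ≤-refl , x , x∈I , y≡

  redundant⁺ : ∀ {a k x} → k < a → T (repeated k x) → T (redundant a x)
  redundant⁺ {suc a} {k} {x} k<1+a t with m<1+n⇒m<n∨m≡n k<1+a
  ... | inj₁ k<a  = from (T-∨ {redundant a x}) (inj₁ (redundant⁺ k<a t))
  ... | inj₂ refl = from (T-∨ {redundant a x}) (inj₂ t)

  reach-size : ∀ a → distinct m (reach a) + repeats a ≤ a * length I
  reach-size zero    = ≤-reflexive (trans (+-identityʳ (distinct m [])) (sum-replicate-zero m))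
  reach-size (suc a) = begin
    distinct m (reach a ++ layer a) + (repeats a + r)  ≡⟨ x∙yz≈xz∙y (distinct m (reach a ++ layer a)) (repeats a) r ⟩
    distinct m (reach a ++ layer a) + r + repeats a    ≤⟨ +-monoˡ-≤ (repeats a) (distinct-++-map m (reach a) (shift m a) I) ⟩
    distinct m (reach a) + length I + repeats a        ≡⟨ xy∙z≈xz∙y (distinct m (reach a)) (length I) (repeats a) ⟩
    distinct m (reach a) + repeats a + length I        ≤⟨ +-monoˡ-≤ (length I) (reach-size a) ⟩
    a * length I + length I                            ≡⟨ +-comm (a * length I) (length I) ⟩
    suc a * length I                                   ∎
    where
    open ≤-Reasoning
    r = countL (repeated a) I

  redundant-count : ∀ a → countL (redundant a) I ≤ repeats a
  redundant-count zero    = ≤-reflexive (countL-false I)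
  redundant-count (suc a) = ≤-trans (countL-∨ (redundant a) (repeated a) I)
                                    (+-monoˡ-≤ (countL (repeated a) I) (redundant-count a))

  -- If x + d ≡ z (mod m) with z ∈ I and d = 2^a − 2^b ∈ 𝓜_Δ, then the a-th
  -- neighbour of x equals the b-th neighbour of z, so x is redundant.
  gap-redundant : ∀ Δ x d {z} → T (inM Δ d) → (x + d) % m ≡ z % m → z ∈ I → T (redundant Δ x)
  gap-redundant Δ x d {z} d∈M x+d≡z z∈I with inM⁻ {Δ} {d} d∈M
  ... | a , a<Δ , b , b<a , refl =
    redundant⁺ a<Δ (fromWitness (subst (_∈ reach a) (sym same-neighbour) (∈-reach⁺ b<a z∈I)))
    where
    open ≡-Reasoning
    same-neighbour : shift m a x ≡ shift m b z
    same-neighbour = begin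
      shift m a x                   ≡⟨ shift≡ m a x ⟩
      (x + offset a) % m            ≡⟨ cong (λ o → (x + o) % m) (offset-gap b<a) ⟩
      (x + (d + offset b)) % m      ≡⟨ cong (_% m) (+-assoc x d (offset b)) ⟨
      (x + d + offset b) % m        ≡⟨ %-cong-+ʳ m (offset b) x+d≡z ⟩
      (z + offset b) % m            ≡⟨ shift≡ m b z ⟨
      shift m b z                   ∎

  cyclic-redundant : ∀ {Δ first} → first ∈ I → ∀ L → (∀ {y} → y ∈ L → y ∈ I) →
    countL (inM Δ) (cycGo m first L) ≤ countL (redundant Δ) L
  cyclic-redundant         _   []           _   = z≤n
  cyclic-redundant {Δ} {f} f∈I (x ∷ [])    _   = +-monoˡ-≤ 0 (𝟙-mono wrap-gap)
    where
    wrap-gap : T (inM Δ (m + f ∸ x)) → T (redundant Δ x)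
    wrap-gap gap∈M = gap-redundant Δ x (m + f ∸ x) gap∈M wraps f∈I
      where
      wraps : (x + (m + f ∸ x)) % m ≡ f % m
      wraps = trans (cong (_% m) (trans (gap-closes {x} (inM-positive {Δ} gap∈M)) (+-comm m f)))
                    ([m+n]%n≡m%n f m)
  cyclic-redundant {Δ}     f∈I (x ∷ y ∷ L) L⊆I =
    +-mono-≤ (𝟙-mono inner-gap) (cyclic-redundant {Δ} f∈I (y ∷ L) (L⊆I ∘ there))
    where
    inner-gap : T (inM Δ (y ∸ x)) → T (redundant Δ x)
    inner-gap gap∈M = gap-redundant Δ x (y ∸ x) gap∈M
      (cong (_% m) (gap-closes {x} (inM-positive {Δ} gap∈M))) (L⊆I (there (here refl)))

module _ {m : ℕ} (A : Subset m) where

  ∈-indices⁺ : ∀ {i} → T (lookup A i) → toℕ i ∈ indices A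
  ∈-indices⁺ {i} i∈A = ∈-map⁺ toℕ (∈-filter⁺ (T? ∘ lookup A) (∈-allFin i) i∈A)

  ∈-indices⁻ : ∀ {x} → x ∈ indices A → ∃[ i ] T (lookup A i) × x ≡ toℕ i
  ∈-indices⁻ x∈ with ∈-map⁻ toℕ {xs = filter (T? ∘ lookup A) (allFin m)} x∈
  ... | i , i∈ , x≡ = i , proj₂ (∈-filter⁻ (T? ∘ lookup A) {xs = allFin m} i∈) , x≡

  length-indices : length (indices A) ≡ ∣ A ∣
  length-indices = begin
    length (indices A)                           ≡⟨ length-map toℕ (filter (T? ∘ lookup A) (allFin m)) ⟩
    length (filter (T? ∘ lookup A) (allFin m))   ≡⟨ length-filter (lookup A) (allFin m) ⟩
    countL (lookup A) (allFin m)                 ≡⟨ countL-tabulate (lookup A) id ⟩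
    count m (lookup A)                           ≡⟨ ∣∣≡count A ⟨
    ∣ A ∣                                        ∎
    where open ≡-Reasoning

∣nbrU∣≡distinct : ∀ m .{{_ : NonZero m}} Δ (A : Subset m) →
  ∣ nbrU m Δ A ∣ ≡ distinct m (Layers.reach m (indices A) Δ)
∣nbrU∣≡distinct m Δ A = trans (∣∣≡count (nbrU m Δ A)) (count-cong m λ j → T-ext (into j) (outof j))
  where
  open Layers m (indices A)
  into : ∀ j → T (lookup (nbrU m Δ A) j) → T (toℕ j ∈ᵇ reach Δ)
  into j v∈N with nbrU⁻ m {Δ} A v∈N
  ... | i , i∈A , i~j with adj⁻ m {Δ} {i} {j} i~j
  ...   | k , k<Δ , hit = fromWitness (subst (_∈ reach Δ) hit (∈-reach⁺ k<Δ (∈-indices⁺ A i∈A)))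
  outof : ∀ j → T (toℕ j ∈ᵇ reach Δ) → T (lookup (nbrU m Δ A) j)
  outof j t with ∈-reach⁻ {Δ} (toWitness t)
  ... | k , k<Δ , x , x∈I , j≡ with ∈-indices⁻ A x∈I
  ...   | i , i∈A , refl = nbrU⁺ m {Δ} A i∈A (adj⁺ m {Δ} {k} {i} k<Δ (sym j≡))

cyclicGaps : ℕ → List ℕ → List ℕ
cyclicGaps m []       = []
cyclicGaps m (x ∷ xs) = cycGo m x (x ∷ xs)

cyclicSeq≡ : ∀ {m} (A : Subset m) → cyclicSeq A ≡ cyclicGaps m (indices A)
cyclicSeq≡ A with indices A
... | []     = refl
... | _ ∷ _  = refl

gaps-redundant : ∀ m .{{_ : NonZero m}} Δ I → countL (inM Δ) (cyclicGaps m I) ≤ countL (Layers.redundant m I Δ) I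
gaps-redundant m Δ []       = z≤n
gaps-redundant m Δ (x ∷ xs) = Layers.cyclic-redundant m (x ∷ xs) {Δ} (here refl) (x ∷ xs) id

neighbourhood-bound : ∀ m .{{_ : NonZero m}} Δ (A : Subset m) → countM Δ A + ∣ nbrU m Δ A ∣ ≤ Δ * ∣ A ∣
neighbourhood-bound m Δ A = begin
  countM Δ A + ∣ nbrU m Δ A ∣          ≤⟨ +-mono-≤ gaps≤repeats (≤-reflexive (∣nbrU∣≡distinct m Δ A)) ⟩
  repeats Δ + distinct m (reach Δ)     ≡⟨ +-comm (repeats Δ) (distinct m (reach Δ)) ⟩
  distinct m (reach Δ) + repeats Δ     ≤⟨ reach-size Δ ⟩
  Δ * length I                         ≡⟨ cong (Δ *_) (length-indices A) ⟩
  Δ * ∣ A ∣                            ∎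
  where
  open ≤-Reasoning
  I = indices A
  open Layers m I
  gaps≤repeats : countM Δ A ≤ repeats Δ
  gaps≤repeats = begin
    countM Δ A                        ≡⟨ length-filter (inM Δ) (cyclicSeq A) ⟩
    countL (inM Δ) (cyclicSeq A)      ≡⟨ cong (countL (inM Δ)) (cyclicSeq≡ A) ⟩
    countL (inM Δ) (cyclicGaps m I)   ≤⟨ gaps-redundant m Δ I ⟩
    countL (redundant Δ) I            ≤⟨ redundant-count Δ ⟩
    repeats Δ                         ∎

-- Δ ≤ ⌊log₂ 2m⌋ = 1 + ⌊log₂ m⌋ says exactly that every offset 2^k, k < Δ, fits in m.
powers-fit : ∀ m .{{_ : NonZero m}} Δ → Δ ≤ ⌊log₂ (2 * m) ⌋ → ∀ k → k < Δ → 2 ^ k ≤ m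
powers-fit m Δ Δ≤log k k<Δ = 2^≤ k m (>-nonZero⁻¹ m) (≤-pred (begin
  suc k                  ≤⟨ k<Δ ⟩
  Δ                      ≤⟨ Δ≤log ⟩
  ⌊log₂ (2 * m) ⌋        ≡⟨ ⌊log₂[2*b]⌋≡1+⌊log₂b⌋ m ⟩
  suc ⌊log₂ m ⌋          ∎))
  where open ≤-Reasoning

lemma2p8 : (n m : ℕ) → n ≡ 2 * m → 2 ≤ n → .{{_ : NonZero m}}
    → (Δ : ℕ) → 1 ≤ Δ → Δ ≤ ⌊log₂ n ⌋
    → (A : Subset m) → Nonempty A
    → (incidenceSum m Δ A ≡ Δ * ∣ A ∣)
    × (countM Δ A + ∣ nbrU m Δ A ∣ ≤ Δ * ∣ A ∣)
lemma2p8 .(2 * m) m refl _ Δ _ Δ≤log A _ =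
  incidence-sum m Δ (powers-fit m Δ Δ≤log) A , neighbourhood-bound m Δ A
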